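{- Let $C$ be a $d$-dimensional smooth combinatorial cube in $\mathbb{R}^d$ with $d\geq 3$. Fix $x,y\in[d]$ with $x\neq y$, and consider the four $(d-2)$-dimensional faces $F_{xy}$, $F_{x\bar y}$, $F_{\bar x y}$, $F_{\bar x\bar y}$. If three of them are parallel to each other, then the fourth is parallel to them as well.
   Context: A $d$-dimensional combinatorial cube $C$ is a polytope whose face poset is isomorphic to that of $[0,1]^d$; fix such an isomorphism. For disjoint $I,J\subseteq[d]$, $F_I^J$ denotes the face of $C$ corresponding to $\{x\in[0,1]^d : x_k=0 \text{ for } k\in I,\ x_k=1\text{ for }k\in J\}$. Shorthand: indices in $I$ are written plainly and indices in $J$ with a bar, e.g. $F_{x\bar y}=F_{\{x\}}^{\{y\}}$, $F_{\bar x\bar y}=F_{\emptyset}^{\{x,y\}}$, $F_{xy}=F_{\{x,y\}}^{\emptyset}$. A $d$-dimensional polytope in $\mathbb{R}^d$ is smooth if it is a lattice polytope, each vertex lies on exactly $d$ edges, and the primitive edge directions at each vertex form a basis of $\mathbb{Z}^d$. Faces are parallel if the linear subspaces parallel to their affine hulls coincide. -}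

module Defs where

open import Data.Nat as ℕ using (ℕ; zero; suc)
open import Data.Integer as ℤ using (ℤ; +_; -[1+_]; _+_; _*_; _-_; _≤_; _<_; ∣_∣; +≤+; -≤+)
import Data.Integer.Properties as ℤP
open import Data.Fin using (Fin; zero; suc; _≟_)
open import Data.Bool using (Bool; true; false; _∧_; _∨_; not; if_then_else_)
open import Data.Product using (Σ; _×_; _,_; proj₁; proj₂)
open import Relation.Nullary using (¬_; yes; no)
open import Relation.Nullary.Decidable using (⌊_⌋)
open import Relation.Binary.PropositionalEquality

Point : ℕ → Set
Point d = Fin d → ℤ

Σℤ : ∀ {n} → (Fin n → ℤ) → ℤ
Σℤ {zero}  f = + 0
Σℤ {suc n} f = f zero + Σℤ (λ i → f (suc i))

_·_ : ∀ {d} → Point d → Point d → ℤ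
u · v = Σℤ (λ k → u k * v k)

_⊆_ : {A : Set} → (A → Bool) → (A → Bool) → Set
S ⊆ T = ∀ a → S a ≡ true → T a ≡ true

-- Faces of the polytope conv{ P a | a : A }, recorded by the set of
-- generating points they contain.  A face is the intersection of the
-- polytope with a (weakly) supporting hyperplane  c·z = b  (c·z ≤ b on
-- the polytope); c = 0 gives the whole polytope and the empty face.

IsFaceOf : ∀ {d} {A : Set} → (A → Point d) → (A → Bool) → Set
IsFaceOf {d} {A} P S =
  Σ (Point d) λ c → Σ ℤ λ b →
    (∀ a → c · P a ≤ b) × (∀ a → (c · P a ≡ b → S a ≡ true) × (S a ≡ true → c · P a ≡ b))

bit : Bool → ℤ
bit true  = + 1
bit false = + 0

cubePt : ∀ {d} → (Fin d → Bool) → Point d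
cubePt v k = bit (v k)

allF : ∀ {n} → (Fin n → Bool) → Bool
allF {zero}  f = true
allF {suc n} f = f zero ∧ allF (λ i → f (suc i))

-- the vertex set of { x ∈ [0,1]^d : x_k = 0 (k ∈ I), x_k = 1 (k ∈ J) }
subcube : ∀ {d} → (I J : Fin d → Bool) → (Fin d → Bool) → Bool
subcube I J v = allF (λ k → (not (I k) ∨ not (v k)) ∧ (not (J k) ∨ v k))

private
  cvec : ∀ {d} → (I J : Fin d → Bool) → Point d
  cvec I J k = bit (J k) - bit (I k)

  okk : Bool → Bool → Bool → Bool
  okk i j v = (not i ∨ not v) ∧ (not j ∨ v)

  term-≤ : ∀ i j v → (bit j - bit i) * bit v ≤ bit j
  term-≤ false false false = +≤+ ℕ.z≤n
  term-≤ false false true  = +≤+ ℕ.z≤n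
  term-≤ false true  false = +≤+ ℕ.z≤n
  term-≤ false true  true  = +≤+ (ℕ.s≤s ℕ.z≤n)
  term-≤ true  false false = +≤+ ℕ.z≤n
  term-≤ true  false true  = -≤+
  term-≤ true  true  false = +≤+ ℕ.z≤n
  term-≤ true  true  true  = +≤+ ℕ.z≤n

  term-eq→ : ∀ i j v → (bit j - bit i) * bit v ≡ bit j → okk i j v ≡ true
  term-eq→ false false false e = refl
  term-eq→ false false true  e = refl
  term-eq→ false true  false ()
  term-eq→ false true  true  e = refl
  term-eq→ true  false false e = refl
  term-eq→ true  false true  ()
  term-eq→ true  true  false ()
  term-eq→ true  true  true  ()

  term-eq← : ∀ i j v → okk i j v ≡ true → (bit j - bit i) * bit v ≡ bit j
  term-eq← false false false e = refl
  term-eq← false false true  e = refl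
  term-eq← false true  false ()
  term-eq← false true  true  e = refl
  term-eq← true  false false e = refl
  term-eq← true  false true  ()
  term-eq← true  true  false ()
  term-eq← true  true  true  ()

  Σ-mono : ∀ {n} (a b : Fin n → ℤ) → (∀ k → a k ≤ b k) → Σℤ a ≤ Σℤ b
  Σ-mono {zero}  a b h = ℤP.≤-refl
  Σ-mono {suc n} a b h = ℤP.+-mono-≤ (h zero) (Σ-mono (λ i → a (suc i)) (λ i → b (suc i)) (λ i → h (suc i)))

  Σ-cong : ∀ {n} (a b : Fin n → ℤ) → (∀ k → a k ≡ b k) → Σℤ a ≡ Σℤ b
  Σ-cong {zero}  a b h = refl
  Σ-cong {suc n} a b h = cong₂ _+_ (h zero) (Σ-cong (λ i → a (suc i)) (λ i → b (suc i)) (λ i → h (suc i)))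

  Σ-eq : ∀ {n} (a b : Fin n → ℤ) → (∀ k → a k ≤ b k) → Σℤ a ≡ Σℤ b → ∀ k → a k ≡ b k
  Σ-eq {suc n} a b h e k with a zero ℤ.≟ b zero
         | Σℤ (λ i → a (suc i)) ℤ.≟ Σℤ (λ i → b (suc i))
  ... | no ne | _ = ⊥-elim′ (ℤP.<-irrefl e (ℤP.+-mono-<-≤ (ℤP.≤∧≢⇒< (h zero) ne)
                      (Σ-mono (λ i → a (suc i)) (λ i → b (suc i)) (λ i → h (suc i)))))
    where ⊥-elim′ : ∀ {X : Set} → _ → X
          ⊥-elim′ ()
  ... | yes _ | no ne = ⊥-elim′ (ℤP.<-irrefl e (ℤP.+-mono-≤-< (h zero) (ℤP.≤∧≢⇒< 
                      (Σ-mono (λ i → a (suc i)) (λ i → b (suc i)) (λ i → h (suc i))) ne)))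
    where ⊥-elim′ : ∀ {X : Set} → _ → X
          ⊥-elim′ ()
  ... | yes e0 | yes e' with k
  ... | zero  = e0
  ... | suc k' = Σ-eq (λ i → a (suc i)) (λ i → b (suc i)) (λ i → h (suc i)) e' k'

  allF→ : ∀ {n} (f : Fin n → Bool) → allF f ≡ true → ∀ k → f k ≡ true
  allF→ {suc n} f e k with f zero in eq
  allF→ {suc n} f () k | false
  allF→ {suc n} f e zero    | true = eq
  allF→ {suc n} f e (suc k) | true = allF→ (λ i → f (suc i)) e k

  allF← : ∀ {n} (f : Fin n → Bool) → (∀ k → f k ≡ true) → allF f ≡ true
  allF← {zero}  f h = refl
  allF← {suc n} f h rewrite h zero = allF← (λ i → f (suc i)) (λ i → h (suc i))

subcube-isFace : ∀ {d} (I J : Fin d → Bool) → IsFaceOf cubePt (subcube I J)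
subcube-isFace {d} I J = cvec I J , Σℤ (λ k → bit (J k)) , le , eqv
  where
  le : ∀ v → cvec I J · cubePt v ≤ Σℤ (λ k → bit (J k))
  le v = Σ-mono _ _ (λ k → term-≤ (I k) (J k) (v k))
  eqv : ∀ v → _
  eqv v = (λ e → allF← _ (λ k → term-eq→ (I k) (J k) (v k)
                   (Σ-eq _ _ (λ k → term-≤ (I k) (J k) (v k)) e k)))
        , (λ s → Σ-cong _ _ (λ k → term-eq← (I k) (J k) (v k) (allF→ _ s k)))

-- Combinatorial cubes: an isomorphism between the face poset of [0,1]^d
-- and that of C = conv{P i}.

record CombCube (d n : ℕ) (P : Fin n → Point d) : Set where
  field
    φ      : (S : (Fin d → Bool) → Bool) → IsFaceOf cubePt S → (Fin n → Bool)
    φ-face : ∀ S p → IsFaceOf P (φ S p)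
    φ-mono : ∀ S p T q → S ⊆ T → φ S p ⊆ φ T q
    φ-refl : ∀ S p T q → φ S p ⊆ φ T q → S ⊆ T
    φ-surj : ∀ G → IsFaceOf P G →
             Σ ((Fin d → Bool) → Bool) λ S → Σ (IsFaceOf cubePt S) λ p → ∀ i → φ S p i ≡ G i

faceIJ : ∀ {d n} {P : Fin n → Point d} → CombCube d n P → (I J : Fin d → Bool) → Fin n → Bool
faceIJ cc I J = CombCube.φ cc (subcube I J) (subcube-isFace I J)

∅ₛ : ∀ {d} → Fin d → Bool
∅ₛ k = false

⟦_⟧₁ : ∀ {d} → Fin d → Fin d → Bool
⟦ x ⟧₁ k = ⌊ k ≟ x ⌋

⟦_,_⟧₂ : ∀ {d} → Fin d → Fin d → Fin d → Bool
⟦ x , y ⟧₂ k = ⌊ k ≟ x ⌋ ∨ ⌊ k ≟ y ⌋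

-- C = conv{P i | i : Fin n}, where every P i is a vertex of C
-- (i.e. {i} is a face; in particular P is injective).

AllVertices : ∀ {d n} → (Fin n → Point d) → Set
AllVertices {d} {n} P = ∀ i → IsFaceOf P (λ j → ⌊ j ≟ i ⌋)

IsEdge : ∀ {d n} → (Fin n → Point d) → Fin n → Fin n → Set
IsEdge P i j = (¬ i ≡ j) × IsFaceOf P (λ k → ⌊ k ≟ i ⌋ ∨ ⌊ k ≟ j ⌋)

_•_ : ∀ {d} → ℤ → Point d → Point d
(m • u) k = m * u k

_⊖ₚ_ : ∀ {d} → Point d → Point d → Point d
(u ⊖ₚ v) k = u k - v k

Primitive : ∀ {d} → Point d → Set
Primitive {d} u = ∀ (m : ℤ) (q : Point d) → (∀ k → u k ≡ m * q k) → ∣ m ∣ ≡ 1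

PrimitiveDirOf : ∀ {d} → Point d → Point d → Set
PrimitiveDirOf u w = Primitive u × Σ ℕ λ m → (0 ℕ.< m) × (∀ k → w k ≡ (+ m) * u k)

IsZBasis : ∀ {d} → (Fin d → Point d) → Set
IsZBasis {d} u =
  (∀ (z : Point d) → Σ (Fin d → ℤ) λ a → ∀ k → z k ≡ Σℤ (λ l → a l * u l k)) ×
  (∀ (a : Fin d → ℤ) → (∀ k → Σℤ (λ l → a l * u l k) ≡ + 0) → ∀ l → a l ≡ + 0)

-- Smoothness (C is a lattice polytope since all P i ∈ ℤ^d): every vertex
-- lies on exactly d edges (enumerated injectively by e), and the primitive
-- edge directions form a basis of ℤ^d.
Smooth : ∀ {d n} → (Fin n → Point d) → Set
Smooth {d} {n} P = ∀ i →
  Σ (Fin d → Fin n) λ e →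
    (∀ k → IsEdge P i (e k)) ×
    (∀ k l → e k ≡ e l → k ≡ l) ×
    (∀ j → IsEdge P i j → Σ (Fin d) λ k → e k ≡ j) ×
    Σ (Fin d → Point d) λ u → (∀ k → PrimitiveDirOf (u k) (P (e k) ⊖ₚ P i)) × IsZBasis u

-- The linear space parallel to aff(F) is the (real) span of
-- the differences P j − P i (i, j ∈ F).  For an integer vector w, w lies
-- in the real span of integer vectors iff some positive multiple m w is an
-- integer combination of them.

InSpanDir : ∀ {d n} → (Fin n → Point d) → (Fin n → Bool) → Point d → Set
InSpanDir {d} {n} P G w =
  Σ ℕ λ m → (0 ℕ.< m) × Σ (Fin n → Fin n → ℤ) λ a →
    ∀ k → (+ m) * w k ≡
      Σℤ (λ i → Σℤ (λ j → if G i ∧ G j then a i j * (P j k - P i k) else + 0))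

Parallel : ∀ {d n} → (Fin n → Point d) → (Fin n → Bool) → (Fin n → Bool) → Set
Parallel P F G =
  (∀ i j → F i ≡ true → F j ≡ true → InSpanDir P G (P j ⊖ₚ P i)) ×
  (∀ i j → G i ≡ true → G j ≡ true → InSpanDir P F (P j ⊖ₚ P i))

ThreeToFourth : ∀ {d n} → (Fin n → Point d) → (a b c e : Fin n → Bool) → Set
ThreeToFourth P a b c e =
  Parallel P a b × Parallel P a c × Parallel P b c →
  Parallel P e a × Parallel P e b × Parallel P e c

{-# OPTIONS --safe #-}
-- Fix a vertex w of the cube and let v be the corresponding vertex of C. By smoothness the
-- primitive edge directions u₁,…,u_d at v form a ℤ-basis. The facet through v transverse to
-- the l-th edge contains all other edges at v, so its supporting hyperplane shows that every
-- vertex of C has a nonnegative l-th coordinate in this basis. Hence, for a face G through v,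
-- the lattice points of the direction space of G are exactly the vectors whose coordinates
-- along the edges leaving G vanish.
--
-- Let E be the face {x = α, y = β}, Eˣ and Eʸ the faces in which x resp. y is flipped, and
-- X ⊇ E ∪ Eʸ, Y ⊇ E ∪ Eˣ the facets {x = α}, {y = β}. If Eˣ ∥ Eʸ, then reading coordinates at a
-- vertex w₀ of E gives span Eˣ ⊆ span X ∩ span Y = span E. Conversely, let z ∈ span E and read
-- it at the neighbour w₁ of w₀ in Eˣ: its coordinates along edges leaving Y vanish, and the
-- normal of X vanishes on z and on every other edge of Eˣ at w₁ (span Eˣ ⊆ span E ⊆ span X),
-- but not on the edge w₁w₀; so the remaining coordinate vanishes as well and z ∈ span Eˣ.
-- Thus E ∥ Eˣ whenever Eˣ ∥ Eʸ; each case of the theorem follows by transitivity.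
module Submission where

open import Defs
open import Data.Nat as ℕ using (ℕ; zero; suc; _≤_)
import Data.Nat.Properties as ℕP
open import Data.Integer as ℤ using (ℤ; +_; -[1+_]; _+_; _*_; _-_; 0ℤ; 1ℤ; -1ℤ)
import Data.Integer.Properties as ℤP
open import Data.Integer.Tactic.RingSolver using (solve-∀)
open import Data.Fin as Fin using (Fin; zero; suc; _≟_)
import Data.Fin.Properties as FinP
open import Data.Bool using (Bool; true; false; not; _∧_; _∨_; if_then_else_)
open import Data.Bool.Properties using (not-involutive; not-¬; ¬-not; ∨-zeroʳ; ⇔→≡)
import Data.Bool as Bool
open import Data.Product using (∃; _×_; _,_; proj₁; proj₂)
open import Data.Sum as Sum using (_⊎_; inj₁; inj₂; [_,_]′; reduce)
open import Data.Empty using (⊥; ⊥-elim)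
open import Function using (_∘_; id; mk⇔)
open import Relation.Nullary using (¬_; yes; no; contradiction)
open import Relation.Nullary.Decidable using (⌊_⌋; isYes≗does; dec-true; dec-false)
open import Relation.Unary using (_∩_) renaming (_⊆_ to _⊆ᵖ_)
open import Relation.Binary.PropositionalEquality
open import Algebra.Properties.Semiring.Sum ℤP.+-*-semiring using (sum; ∑-distrib-+; ∑-comm; *-distribˡ-sum)
open import Algebra.Properties.CommutativeSemigroup ℤP.*-commutativeSemigroup using (x∙yz≈y∙xz)

Σℤ≡sum : ∀ {n} (f : Fin n → ℤ) → Σℤ f ≡ sum f
Σℤ≡sum {zero}  f = refl
Σℤ≡sum {suc n} f = cong (_+_ (f zero)) (Σℤ≡sum (f ∘ suc))

Σℤ-cong : ∀ {n} {f g : Fin n → ℤ} → f ≗ g → Σℤ f ≡ Σℤ g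
Σℤ-cong {zero}  f≗g = refl
Σℤ-cong {suc n} f≗g = cong₂ _+_ (f≗g zero) (Σℤ-cong (f≗g ∘ suc))

Σℤ-zero : ∀ {n} {f : Fin n → ℤ} → (∀ i → f i ≡ 0ℤ) → Σℤ f ≡ 0ℤ
Σℤ-zero {zero}  f≡0 = refl
Σℤ-zero {suc n} f≡0 = cong₂ _+_ (f≡0 zero) (Σℤ-zero (f≡0 ∘ suc))

Σℤ-+ : ∀ {n} (f g : Fin n → ℤ) → Σℤ (λ i → f i + g i) ≡ Σℤ f + Σℤ g
Σℤ-+ f g = begin
  Σℤ (λ i → f i + g i)  ≡⟨ Σℤ≡sum (λ i → f i + g i) ⟩
  sum (λ i → f i + g i) ≡⟨ ∑-distrib-+ f g ⟩
  sum f + sum g         ≡⟨ sym (cong₂ _+_ (Σℤ≡sum f) (Σℤ≡sum g)) ⟩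
  Σℤ f + Σℤ g           ∎
  where open ≡-Reasoning

Σℤ-*ˡ : ∀ {n} c (f : Fin n → ℤ) → Σℤ (λ i → c * f i) ≡ c * Σℤ f
Σℤ-*ˡ c f = begin
  Σℤ (λ i → c * f i)  ≡⟨ Σℤ≡sum (λ i → c * f i) ⟩
  sum (λ i → c * f i) ≡⟨ sym (*-distribˡ-sum c f) ⟩
  c * sum f           ≡⟨ sym (cong (c *_) (Σℤ≡sum f)) ⟩
  c * Σℤ f            ∎
  where open ≡-Reasoning

Σℤ-comm : ∀ {m n} (f : Fin m → Fin n → ℤ) →
          Σℤ (λ i → Σℤ (λ j → f i j)) ≡ Σℤ (λ j → Σℤ (λ i → f i j))
Σℤ-comm f = begin
  Σℤ (λ i → Σℤ (f i))                ≡⟨ Σℤ-cong (λ i → Σℤ≡sum (f i)) ⟩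
  Σℤ (λ i → sum (f i))               ≡⟨ Σℤ≡sum (λ i → sum (f i)) ⟩
  sum (λ i → sum (f i))              ≡⟨ ∑-comm f ⟩
  sum (λ j → sum (λ i → f i j))      ≡⟨ sym (Σℤ≡sum (λ j → sum (λ i → f i j))) ⟩
  Σℤ (λ j → sum (λ i → f i j))       ≡⟨ Σℤ-cong (λ j → sym (Σℤ≡sum (λ i → f i j))) ⟩
  Σℤ (λ j → Σℤ (λ i → f i j))        ∎
  where open ≡-Reasoning

Σℤ-single : ∀ {n} (f : Fin n → ℤ) i₀ → (∀ i → i ≢ i₀ → f i ≡ 0ℤ) → Σℤ f ≡ f i₀
Σℤ-single f zero     f≡0 = trans (cong (_+_ (f zero)) (Σℤ-zero (λ i → f≡0 (suc i) λ ())))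
                                 (ℤP.+-identityʳ (f zero))
Σℤ-single f (suc i₀) f≡0 = begin
  f zero + Σℤ (f ∘ suc) ≡⟨ cong (_+ Σℤ (f ∘ suc)) (f≡0 zero λ ()) ⟩
  0ℤ + Σℤ (f ∘ suc)     ≡⟨ ℤP.+-identityˡ _ ⟩
  Σℤ (f ∘ suc)          ≡⟨ Σℤ-single (f ∘ suc) i₀ (λ i i≢i₀ → f≡0 (suc i) (i≢i₀ ∘ FinP.suc-injective)) ⟩
  f (suc i₀)            ∎
  where open ≡-Reasoning

Σℤ-nonPos : ∀ {n} (f : Fin n → ℤ) → (∀ i → f i ℤ.≤ 0ℤ) → Σℤ f ℤ.≤ 0ℤ
Σℤ-nonPos {zero}  f f≤0 = ℤP.≤-refl
Σℤ-nonPos {suc n} f f≤0 = ℤP.+-mono-≤ (f≤0 zero) (Σℤ-nonPos (f ∘ suc) (f≤0 ∘ suc))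

+-nonPos-≡0ˡ : ∀ {a b} → a ℤ.≤ 0ℤ → b ℤ.≤ 0ℤ → a + b ≡ 0ℤ → a ≡ 0ℤ
+-nonPos-≡0ˡ {a} {b} a≤0 b≤0 a+b≡0 =
  ℤP.≤-antisym a≤0 (subst (ℤ._≤ a) a+b≡0 (subst (a + b ℤ.≤_) (ℤP.+-identityʳ a) (ℤP.+-monoʳ-≤ a b≤0)))

Σℤ-nonPos-≡0 : ∀ {n} (f : Fin n → ℤ) → (∀ i → f i ℤ.≤ 0ℤ) → Σℤ f ≡ 0ℤ → ∀ i → f i ≡ 0ℤ
Σℤ-nonPos-≡0 f f≤0 Σ≡0 zero    = +-nonPos-≡0ˡ (f≤0 zero) (Σℤ-nonPos _ (f≤0 ∘ suc)) Σ≡0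
Σℤ-nonPos-≡0 f f≤0 Σ≡0 (suc i) = Σℤ-nonPos-≡0 (f ∘ suc) (f≤0 ∘ suc)
  (+-nonPos-≡0ˡ (Σℤ-nonPos _ (f≤0 ∘ suc)) (f≤0 zero) (trans (ℤP.+-comm _ (f zero)) Σ≡0)) i

pos*-≤0 : ∀ {m t} → 0 ℕ.< m → + m * t ℤ.≤ 0ℤ → t ℤ.≤ 0ℤ
pos*-≤0 {suc m} {t} _ mt≤0 =
  ℤP.*-cancelˡ-≤-pos t 0ℤ (+ suc m) (subst (+ suc m * t ℤ.≤_) (sym (ℤP.*-zeroʳ (+ suc m))) mt≤0)

pos*-≡0 : ∀ {m t} → 0 ℕ.< m → + m * t ≡ 0ℤ → t ≡ 0ℤ
pos*-≡0 {suc m} {t} _ mt≡0 = ℤP.*-cancelˡ-≡ (+ suc m) t 0ℤ (trans mt≡0 (sym (ℤP.*-zeroʳ (+ suc m))))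

*-neg-≤0⇒0≤ : ∀ a b → a * b ℤ.≤ 0ℤ → b ℤ.< 0ℤ → 0ℤ ℤ.≤ a
*-neg-≤0⇒0≤ a (+ _)    _     (ℤ.+<+ ())
*-neg-≤0⇒0≤ a -[1+ n ] ab≤0 _ = ℤP.*-cancelʳ-≤-neg a 0ℤ -[1+ n ] ab≤0

nonNeg*nonPos≤0 : ∀ {a b} → 0ℤ ℤ.≤ a → b ℤ.≤ 0ℤ → a * b ℤ.≤ 0ℤ
nonNeg*nonPos≤0 {+ n} {b} _ b≤0 = subst (+ n * b ℤ.≤_) (ℤP.*-zeroʳ (+ n)) (ℤP.*-monoˡ-≤-nonNeg (+ n) b≤0)

0<*0< : ∀ {m n} → 0 ℕ.< m → 0 ℕ.< n → 0 ℕ.< m ℕ.* n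
0<*0< {suc m} {suc n} _ _ = ℕ.s≤s ℕ.z≤n

⌊≟⌋-refl : ∀ {d} (k : Fin d) → ⌊ k ≟ k ⌋ ≡ true
⌊≟⌋-refl k = trans (isYes≗does (k ≟ k)) (dec-true (k ≟ k) refl)

⌊≟⌋-≢ : ∀ {d} {i k : Fin d} → i ≢ k → ⌊ i ≟ k ⌋ ≡ false
⌊≟⌋-≢ {i = i} {k} i≢k = trans (isYes≗does (i ≟ k)) (dec-false (i ≟ k) i≢k)

⌊≟⌋⇒≡ : ∀ {d} {i k : Fin d} → ⌊ i ≟ k ⌋ ≡ true → i ≡ k
⌊≟⌋⇒≡ {i = i} {k} i≟k with i ≟ k
⌊≟⌋⇒≡ _  | yes i≡k = i≡k
⌊≟⌋⇒≡ () | no _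

-- Opaque: unfolding these definitions inside later goals makes type checking very slow.
opaque
  Fin-injective⇒surjective : ∀ {m} (f : Fin m → Fin m) → (∀ {a b} → f a ≡ f b → a ≡ b) →
                             ∀ l → ∃ λ k → f k ≡ l
  Fin-injective⇒surjective {suc m} f f-injective l with FinP.any? (λ k → f k ≟ l)
  ... | yes hit  = hit
  ... | no  miss = contradiction (FinP.injective⇒≤ g-injective) ℕP.1+n≰n
    where
    l≢f : ∀ k → l ≢ f k
    l≢f k l≡fk = miss (k , sym l≡fk)
    g : Fin (suc m) → Fin m
    g k = Fin.punchOut (l≢f k)
    g-injective : ∀ {a b} → g a ≡ g b → a ≡ b
    g-injective {a} {b} ga≡gb = f-injective (FinP.punchOut-injective (l≢f a) (l≢f b) ga≡gb)

0ᵥ : ∀ {d} → Point d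
0ᵥ _ = 0ℤ

_⊕_ : ∀ {d} → Point d → Point d → Point d
(z ⊕ z′) k = z k + z′ k

Σᵥ : ∀ {d n} → (Fin n → Point d) → Point d
Σᵥ g k = Σℤ (λ i → g i k)

·-resp : ∀ {d} (c : Point d) {z z′} → z ≗ z′ → c · z ≡ c · z′
·-resp c z≗z′ = Σℤ-cong (λ k → cong (c k *_) (z≗z′ k))

·-0ᵥ : ∀ {d} (c : Point d) → c · 0ᵥ ≡ 0ℤ
·-0ᵥ c = Σℤ-zero (λ k → ℤP.*-zeroʳ (c k))

·-⊕ : ∀ {d} (c z z′ : Point d) → c · (z ⊕ z′) ≡ c · z + c · z′
·-⊕ c z z′ = trans (Σℤ-cong (λ k → ℤP.*-distribˡ-+ (c k) (z k) (z′ k)))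
                   (Σℤ-+ (λ k → c k * z k) (λ k → c k * z′ k))

·-• : ∀ {d} (c : Point d) m (z : Point d) → c · (m • z) ≡ m * (c · z)
·-• c m z = trans (Σℤ-cong (λ k → x∙yz≈y∙xz (c k) m (z k))) (Σℤ-*ˡ m (λ k → c k * z k))

·-⊖ : ∀ {d} (c z z′ : Point d) → c · (z ⊖ₚ z′) ≡ c · z - c · z′
·-⊖ c z z′ = begin
  c · (z ⊖ₚ z′)            ≡⟨ ·-resp c (λ k → cong (_+_ (z k)) (sym (ℤP.-1*i≡-i (z′ k)))) ⟩
  c · (z ⊕ (-1ℤ • z′))     ≡⟨ ·-⊕ c z (-1ℤ • z′) ⟩
  c · z + c · (-1ℤ • z′)   ≡⟨ cong (_+_ (c · z)) (trans (·-• c -1ℤ z′) (ℤP.-1*i≡-i (c · z′))) ⟩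
  c · z - c · z′           ∎
  where open ≡-Reasoning

-- The lattice points of a linear subspace of ℚᵈ.
record IsSaturatedSublattice {d} (L : Point d → Set) : Set where
  field
    ∈-resp-≗ : ∀ {z z′} → z ≗ z′ → L z → L z′
    0ᵥ∈      : L 0ᵥ
    ⊕∈       : ∀ {z z′} → L z → L z′ → L (z ⊕ z′)
    •∈       : ∀ c {z} → L z → L (c • z)
    ∈-divide : ∀ m {z} → 0 ℕ.< m → L ((+ m) • z) → L z

  ⊖∈ : ∀ {z z′} → L z → L z′ → L (z ⊖ₚ z′)
  ⊖∈ {z} {z′} z∈ z′∈ = ∈-resp-≗ (λ k → cong (_+_ (z k)) (ℤP.-1*i≡-i (z′ k))) (⊕∈ z∈ (•∈ -1ℤ z′∈))

  Σᵥ∈ : ∀ {n} (g : Fin n → Point d) → (∀ i → L (g i)) → L (Σᵥ g)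
  Σᵥ∈ {zero}  g g∈ = 0ᵥ∈
  Σᵥ∈ {suc n} g g∈ = ⊕∈ {g zero} {Σᵥ (g ∘ suc)} (g∈ zero) (Σᵥ∈ (g ∘ suc) (g∈ ∘ suc))

dotKernel-saturated : ∀ {d} (c : Point d) → IsSaturatedSublattice (λ z → c · z ≡ 0ℤ)
dotKernel-saturated c = record
  { ∈-resp-≗ = λ z≗z′ c·z≡0 → trans (sym (·-resp c z≗z′)) c·z≡0
  ; 0ᵥ∈      = ·-0ᵥ c
  ; ⊕∈       = λ {z} {z′} c·z≡0 c·z′≡0 → trans (·-⊕ c z z′) (cong₂ _+_ c·z≡0 c·z′≡0)
  ; •∈       = λ m {z} c·z≡0 → trans (·-• c m z) (trans (cong (m *_) c·z≡0) (ℤP.*-zeroʳ m))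
  ; ∈-divide = λ { (suc m) {z} _ c·mz≡0 →
                 ℤP.*-cancelˡ-≡ (+ suc m) (c · z) 0ℤ
                   (trans (sym (·-• c (+ suc m) z)) (trans c·mz≡0 (sym (ℤP.*-zeroʳ (+ suc m))))) }
  }

module _ {d n} (P : Fin n → Point d) (G : Fin n → Bool) where

  spanTerm : (Fin n → Fin n → ℤ) → Fin n → Fin n → Point d
  spanTerm a i j k = if G i ∧ G j then a i j * (P j k - P i k) else 0ℤ

  spanSum : (Fin n → Fin n → ℤ) → Point d
  spanSum a = Σᵥ (λ i → Σᵥ (spanTerm a i))

  spanSum-⊕ : ∀ a b → spanSum (λ i j → a i j + b i j) ≗ spanSum a ⊕ spanSum b
  spanSum-⊕ a b k = trans
    (Σℤ-cong (λ i → trans (Σℤ-cong (λ j → masked-+ (G i ∧ G j) (a i j) (b i j) (P j k - P i k)))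
                          (Σℤ-+ (λ j → spanTerm a i j k) (λ j → spanTerm b i j k))))
    (Σℤ-+ (λ i → Σℤ (λ j → spanTerm a i j k)) (λ i → Σℤ (λ j → spanTerm b i j k)))
    where
    masked-+ : ∀ g a b t → (if g then (a + b) * t else 0ℤ) ≡ (if g then a * t else 0ℤ) + (if g then b * t else 0ℤ)
    masked-+ true  a b t = ℤP.*-distribʳ-+ t a b
    masked-+ false a b t = refl

  spanSum-• : ∀ c a → spanSum (λ i j → c * a i j) ≗ c • spanSum a
  spanSum-• c a k = trans
    (Σℤ-cong (λ i → trans (Σℤ-cong (λ j → masked-* (G i ∧ G j) (a i j) (P j k - P i k)))
                          (Σℤ-*ˡ c (λ j → spanTerm a i j k))))
    (Σℤ-*ˡ c (λ i → Σℤ (λ j → spanTerm a i j k)))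
    where
    masked-* : ∀ g a t → (if g then (c * a) * t else 0ℤ) ≡ c * (if g then a * t else 0ℤ)
    masked-* true  a t = ℤP.*-assoc c a t
    masked-* false a t = sym (ℤP.*-zeroʳ c)

  span-saturated : IsSaturatedSublattice (InSpanDir P G)
  span-saturated = record
    { ∈-resp-≗ = λ z≗z′ (m , m>0 , a , e) → m , m>0 , a , λ k → trans (cong (+ m *_) (sym (z≗z′ k))) (e k)
    ; 0ᵥ∈      = 1 , ℕ.s≤s ℕ.z≤n , (λ _ _ → 0ℤ) , λ k → sym (spanSum-• 0ℤ (λ _ _ → 0ℤ) k)
    ; ⊕∈       = ⊕∈
    ; •∈       = •∈
    ; ∈-divide = λ m₀ {z} m₀>0 (m , m>0 , a , e) →
        m ℕ.* m₀ , 0<*0< m>0 m₀>0 , a , λ k →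
          trans (cong (_* z k) (ℤP.pos-* m m₀)) (trans (ℤP.*-assoc (+ m) (+ m₀) (z k)) (e k))
    }
    where
    ⊕∈ : ∀ {z z′} → InSpanDir P G z → InSpanDir P G z′ → InSpanDir P G (z ⊕ z′)
    ⊕∈ {z} {z′} (m₁ , m₁>0 , a₁ , e₁) (m₂ , m₂>0 , a₂ , e₂) =
      m₁ ℕ.* m₂ , 0<*0< m₁>0 m₂>0 , (λ i j → + m₂ * a₁ i j + + m₁ * a₂ i j) , λ k → begin
        + (m₁ ℕ.* m₂) * (z k + z′ k)                      ≡⟨ cong (_* (z k + z′ k)) (ℤP.pos-* m₁ m₂) ⟩
        (+ m₁ * + m₂) * (z k + z′ k)                      ≡⟨ regroup (+ m₁) (+ m₂) (z k) (z′ k) ⟩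
        + m₂ * (+ m₁ * z k) + + m₁ * (+ m₂ * z′ k)        ≡⟨ cong₂ (λ s t → + m₂ * s + + m₁ * t) (e₁ k) (e₂ k) ⟩
        + m₂ * spanSum a₁ k + + m₁ * spanSum a₂ k         ≡⟨ sym (cong₂ _+_ (spanSum-• (+ m₂) a₁ k) (spanSum-• (+ m₁) a₂ k)) ⟩
        spanSum (λ i j → + m₂ * a₁ i j) k + spanSum (λ i j → + m₁ * a₂ i j) k
                                                          ≡⟨ sym (spanSum-⊕ (λ i j → + m₂ * a₁ i j) (λ i j → + m₁ * a₂ i j) k) ⟩
        spanSum (λ i j → + m₂ * a₁ i j + + m₁ * a₂ i j) k ∎
      where
      open ≡-Reasoning
      regroup : ∀ p q s t → (p * q) * (s + t) ≡ q * (p * s) + p * (q * t)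
      regroup = solve-∀
    •∈ : ∀ c {z} → InSpanDir P G z → InSpanDir P G (c • z)
    •∈ c {z} (m , m>0 , a , e) = m , m>0 , (λ i j → c * a i j) , λ k → begin
      + m * (c * z k) ≡⟨ x∙yz≈y∙xz (+ m) c (z k) ⟩
      c * (+ m * z k) ≡⟨ cong (c *_) (e k) ⟩
      c * spanSum a k ≡⟨ sym (spanSum-• c a k) ⟩
      spanSum (λ i j → c * a i j) k ∎
      where open ≡-Reasoning

  span-∋-diff : ∀ {i j} → G i ≡ true → G j ≡ true → InSpanDir P G (P j ⊖ₚ P i)
  span-∋-diff {i} {j} gi gj = 1 , ℕ.s≤s ℕ.z≤n , δ , λ k → sym (begin
    spanSum δ k                  ≡⟨ Σℤ-single _ i (λ i′ i′≢i → Σℤ-zero (λ j′ → off-row {j′ = j′} i′≢i k)) ⟩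
    Σℤ (λ j′ → spanTerm δ i j′ k) ≡⟨ Σℤ-single _ j (λ j′ j′≢j → off-column j′≢j k) ⟩
    spanTerm δ i j k             ≡⟨ diagonal k ⟩
    1ℤ * (P j k - P i k)         ∎)
    where
    open ≡-Reasoning
    δ : Fin n → Fin n → ℤ
    δ i′ j′ = if ⌊ i′ ≟ i ⌋ ∧ ⌊ j′ ≟ j ⌋ then 1ℤ else 0ℤ
    masked-0 : ∀ g → (if g then 0ℤ else 0ℤ) ≡ 0ℤ
    masked-0 true  = refl
    masked-0 false = refl
    off-row : ∀ {i′ j′} → i′ ≢ i → ∀ k → spanTerm δ i′ j′ k ≡ 0ℤ
    off-row {i′} {j′} i′≢i k rewrite ⌊≟⌋-≢ i′≢i = masked-0 (G i′ ∧ G j′)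
    off-column : ∀ {j′} → j′ ≢ j → ∀ k → spanTerm δ i j′ k ≡ 0ℤ
    off-column {j′} j′≢j k rewrite ⌊≟⌋-refl i | ⌊≟⌋-≢ j′≢j = masked-0 (G i ∧ G j′)
    diagonal : ∀ k → spanTerm δ i j k ≡ 1ℤ * (P j k - P i k)
    diagonal k rewrite gi | gj | ⌊≟⌋-refl i | ⌊≟⌋-refl j = refl

  span-least : ∀ {L} → IsSaturatedSublattice L →
               (∀ i j → G i ≡ true → G j ≡ true → L (P j ⊖ₚ P i)) → InSpanDir P G ⊆ᵖ L
  span-least {L} L-sat gen (m , m>0 , a , e) =
    ∈-divide m m>0 (∈-resp-≗ (λ k → sym (e k)) (Σᵥ∈ _ (λ i → Σᵥ∈ _ (term∈ i))))
    where
    open IsSaturatedSublattice L-sat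
    term∈ : ∀ i j → L (spanTerm a i j)
    term∈ i j with G i in gi | G j in gj
    ... | true  | true  = •∈ (a i j) (gen i j gi gj)
    ... | true  | false = 0ᵥ∈
    ... | false | _     = 0ᵥ∈

  span-least-based : ∀ {L v} → IsSaturatedSublattice L → G v ≡ true →
                     (∀ j → G j ≡ true → L (P j ⊖ₚ P v)) → InSpanDir P G ⊆ᵖ L
  span-least-based {L} {v} L-sat gv gen = span-least L-sat λ i j gi gj →
    ∈-resp-≗ (λ k → telescope (P j k) (P i k) (P v k)) (⊖∈ (gen j gj) (gen i gi))
    where
    open IsSaturatedSublattice L-sat
    telescope : ∀ a b c → (a - c) - (b - c) ≡ a - b
    telescope = solve-∀

span-mono : ∀ {d n} (P : Fin n → Point d) {F G} → F ⊆ G → InSpanDir P F ⊆ᵖ InSpanDir P G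
span-mono P {F} {G} F⊆G = span-least P F (span-saturated P G) λ i j fi fj → span-∋-diff P G (F⊆G i fi) (F⊆G j fj)

module _ {d n} (P : Fin n → Point d) where

  Parallel⇒span-⊆ : ∀ {F G} → Parallel P F G → InSpanDir P F ⊆ᵖ InSpanDir P G
  Parallel⇒span-⊆ {F} {G} (F-diff∈G , _) = span-least P F (span-saturated P G) F-diff∈G

  span-⊆⇒Parallel : ∀ {F G} → InSpanDir P F ⊆ᵖ InSpanDir P G → InSpanDir P G ⊆ᵖ InSpanDir P F → Parallel P F G
  span-⊆⇒Parallel {F} {G} F⊆G G⊆F = (λ i j fi fj → F⊆G (span-∋-diff P F fi fj))
                                  , (λ i j gi gj → G⊆F (span-∋-diff P G gi gj))

  Parallel-sym : ∀ {F G} → Parallel P F G → Parallel P G F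
  Parallel-sym (F-diff∈G , G-diff∈F) = G-diff∈F , F-diff∈G

  Parallel-trans : ∀ {F G H} → Parallel P F G → Parallel P G H → Parallel P F H
  Parallel-trans F∥G G∥H = span-⊆⇒Parallel
    (λ z∈F → Parallel⇒span-⊆ G∥H (Parallel⇒span-⊆ F∥G z∈F))
    (λ z∈H → Parallel⇒span-⊆ (Parallel-sym F∥G) (Parallel⇒span-⊆ (Parallel-sym G∥H) z∈H))

module SupportingHyperplane {d n} {P : Fin n → Point d} {G : Fin n → Bool} (face : IsFaceOf P G) where

  normal : Point d
  normal = proj₁ face

  level : ℤ
  level = proj₁ (proj₂ face)

  normal·≤level : ∀ j → normal · P j ℤ.≤ level
  normal·≤level = proj₁ (proj₂ (proj₂ face))

  level⇒∈ : ∀ {j} → normal · P j ≡ level → G j ≡ true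
  level⇒∈ {j} = proj₁ (proj₂ (proj₂ (proj₂ face)) j)

  ∈⇒level : ∀ {j} → G j ≡ true → normal · P j ≡ level
  ∈⇒level {j} = proj₂ (proj₂ (proj₂ (proj₂ face)) j)

  normal·diff : ∀ {i} j → G i ≡ true → normal · (P j ⊖ₚ P i) ≡ normal · P j - level
  normal·diff {i} j gi = trans (·-⊖ normal (P j) (P i)) (cong (_-_ (normal · P j)) (∈⇒level gi))

  normal·diff-≤0 : ∀ {i} j → G i ≡ true → normal · (P j ⊖ₚ P i) ℤ.≤ 0ℤ
  normal·diff-≤0 j gi rewrite normal·diff j gi = ℤP.i≤j⇒i-j≤0 (normal·≤level j)

  normal·diff-≡0 : ∀ {i j} → G i ≡ true → G j ≡ true → normal · (P j ⊖ₚ P i) ≡ 0ℤ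
  normal·diff-≡0 {j = j} gi gj rewrite normal·diff j gi = ℤP.i≡j⇒i-j≡0 (∈⇒level gj)

  normal·diff-≡0⇒∈ : ∀ {i j} → G i ≡ true → normal · (P j ⊖ₚ P i) ≡ 0ℤ → G j ≡ true
  normal·diff-≡0⇒∈ {j = j} gi ≡0 rewrite normal·diff j gi = level⇒∈ (ℤP.i-j≡0⇒i≡j _ _ ≡0)

  normal·diff-≡0⇒∈′ : ∀ {i j} → G j ≡ true → normal · (P j ⊖ₚ P i) ≡ 0ℤ → G i ≡ true
  normal·diff-≡0⇒∈′ {i} {j} gj ≡0 =
    level⇒∈ (trans (sym (ℤP.i-j≡0⇒i≡j _ _ (trans (sym (·-⊖ normal (P j) (P i))) ≡0))) (∈⇒level gj))

  span⊆kernel : InSpanDir P G ⊆ᵖ (λ z → normal · z ≡ 0ℤ)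
  span⊆kernel = span-least P G (dotKernel-saturated normal) (λ i j gi gj → normal·diff-≡0 gi gj)

combination : ∀ {d m} → (Fin m → ℤ) → (Fin m → Point d) → Point d
combination a u = Σᵥ (λ l → a l • u l)

module _ {d m} (u : Fin m → Point d) where

  combination-⊕ : ∀ a b → combination (a ⊕ b) u ≗ combination a u ⊕ combination b u
  combination-⊕ a b k =
    trans (Σℤ-cong (λ l → ℤP.*-distribʳ-+ (u l k) (a l) (b l))) (Σℤ-+ (λ l → a l * u l k) (λ l → b l * u l k))

  combination-• : ∀ c a → combination (c • a) u ≗ c • combination a u
  combination-• c a k = trans (Σℤ-cong (λ l → ℤP.*-assoc c (a l) (u l k))) (Σℤ-*ˡ c (λ l → a l * u l k))

  combination-⊖ : ∀ a b → combination (a ⊖ₚ b) u ≗ combination a u ⊖ₚ combination b u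
  combination-⊖ a b k = begin
    combination (a ⊖ₚ b) u k                          ≡⟨ Σℤ-cong (λ l → cong (_* u l k) (cong (_+_ (a l)) (sym (ℤP.-1*i≡-i (b l))))) ⟩
    combination (a ⊕ (-1ℤ • b)) u k                   ≡⟨ combination-⊕ a (-1ℤ • b) k ⟩
    combination a u k + combination (-1ℤ • b) u k     ≡⟨ cong (_+_ (combination a u k)) (combination-• -1ℤ b k) ⟩
    combination a u k + -1ℤ * combination b u k       ≡⟨ cong (_+_ (combination a u k)) (ℤP.-1*i≡-i _) ⟩
    combination a u k - combination b u k             ∎
    where open ≡-Reasoning

  ·-combination : ∀ (c : Point d) a → c · combination a u ≡ Σℤ (λ l → a l * (c · u l))
  ·-combination c a = begin
    Σℤ (λ k → c k * Σℤ (λ l → a l * u l k))      ≡⟨ Σℤ-cong (λ k → sym (Σℤ-*ˡ (c k) (λ l → a l * u l k))) ⟩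
    Σℤ (λ k → Σℤ (λ l → c k * (a l * u l k)))    ≡⟨ Σℤ-comm (λ k l → c k * (a l * u l k)) ⟩
    Σℤ (λ l → Σℤ (λ k → c k * (a l * u l k)))    ≡⟨ Σℤ-cong (λ l → Σℤ-cong (λ k → x∙yz≈y∙xz (c k) (a l) (u l k))) ⟩
    Σℤ (λ l → Σℤ (λ k → a l * (c k * u l k)))    ≡⟨ Σℤ-cong (λ l → Σℤ-*ˡ (a l) (λ k → c k * u l k)) ⟩
    Σℤ (λ l → a l * (c · u l))                   ∎
    where open ≡-Reasoning

module Coordinates {d} {u : Fin d → Point d} (basis : IsZBasis u) where

  coord : Point d → Fin d → ℤ
  coord z = proj₁ (proj₁ basis z)

  coord-expansion : ∀ z → z ≗ combination (coord z) u
  coord-expansion z = proj₂ (proj₁ basis z)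

  coord-unique : ∀ {z a} → z ≗ combination a u → ∀ l → coord z l ≡ a l
  coord-unique {z} {a} z≗ l = ℤP.i-j≡0⇒i≡j _ _ (proj₂ basis (coord z ⊖ₚ a) vanishes l)
    where
    vanishes : ∀ k → combination (coord z ⊖ₚ a) u k ≡ 0ℤ
    vanishes k = begin
      combination (coord z ⊖ₚ a) u k                    ≡⟨ combination-⊖ u (coord z) a k ⟩
      combination (coord z) u k - combination a u k     ≡⟨ cong₂ _-_ (sym (coord-expansion z k)) (sym (z≗ k)) ⟩
      z k - z k                                         ≡⟨ ℤP.+-inverseʳ (z k) ⟩
      0ℤ                                                ∎
      where open ≡-Reasoning

  coord-resp : ∀ {z z′} → z ≗ z′ → ∀ l → coord z l ≡ coord z′ l
  coord-resp {z} z≗z′ l = sym (coord-unique {a = coord z} (λ k → trans (sym (z≗z′ k)) (coord-expansion z k)) l)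

  coord-0ᵥ : ∀ l → coord 0ᵥ l ≡ 0ℤ
  coord-0ᵥ = coord-unique {a = 0ᵥ} (λ k → sym (Σℤ-zero {f = λ l → 0ℤ * u l k} (λ l → refl)))

  coord-⊕ : ∀ z z′ l → coord (z ⊕ z′) l ≡ coord z l + coord z′ l
  coord-⊕ z z′ = coord-unique λ k →
    trans (cong₂ _+_ (coord-expansion z k) (coord-expansion z′ k)) (sym (combination-⊕ u (coord z) (coord z′) k))

  coord-• : ∀ c z l → coord (c • z) l ≡ c * coord z l
  coord-• c z = coord-unique λ k →
    trans (cong (c *_) (coord-expansion z k)) (sym (combination-• u c (coord z) k))

  ·-expansion : ∀ (c z : Point d) → c · z ≡ Σℤ (λ l → coord z l * (c · u l))
  ·-expansion c z = trans (·-resp c (coord-expansion z)) (·-combination u c (coord z))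

  coordKernel-saturated : (D : Fin d → Set) → IsSaturatedSublattice (λ z → ∀ l → D l → coord z l ≡ 0ℤ)
  coordKernel-saturated D = record
    { ∈-resp-≗ = λ z≗z′ z∈ l dl → trans (sym (coord-resp z≗z′ l)) (z∈ l dl)
    ; 0ᵥ∈      = λ l _ → coord-0ᵥ l
    ; ⊕∈       = λ {z} {z′} z∈ z′∈ l dl → trans (coord-⊕ z z′ l) (cong₂ _+_ (z∈ l dl) (z′∈ l dl))
    ; •∈       = λ c {z} z∈ l dl → trans (coord-• c z l) (trans (cong (c *_) (z∈ l dl)) (ℤP.*-zeroʳ c))
    ; ∈-divide = λ { (suc m) {z} _ mz∈ l dl → ℤP.*-cancelˡ-≡ (+ suc m) (coord z l) 0ℤ
                     (trans (sym (coord-• (+ suc m) z l)) (trans (mz∈ l dl) (sym (ℤP.*-zeroʳ (+ suc m))))) }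
    }

Vertex : ℕ → Set
Vertex d = Fin d → Bool

agree-off : ∀ {d} {a b : Vertex d} k → a k ≡ b k → (∀ {i} → i ≢ k → a i ≡ b i) → a ≗ b
agree-off k ak≡bk off i with i ≟ k
... | yes refl = ak≡bk
... | no  i≢k  = off i≢k

not⌊≟⌋⇒≢ : ∀ {d} {i k : Fin d} → not ⌊ i ≟ k ⌋ ≡ true → i ≢ k
not⌊≟⌋⇒≢ {i = i} i∈ refl = contradiction (trans (sym i∈) (cong not (⌊≟⌋-refl i))) λ ()

opaque
  toggle : ∀ {d} → Vertex d → Fin d → Vertex d
  toggle w k i = if ⌊ i ≟ k ⌋ then not (w i) else w i

  toggle-≡ : ∀ {d} (w : Vertex d) k → toggle w k k ≡ not (w k)
  toggle-≡ w k rewrite ⌊≟⌋-refl k = refl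

  toggle-≢ : ∀ {d} (w : Vertex d) {k i} → i ≢ k → toggle w k i ≡ w i
  toggle-≢ w i≢k rewrite ⌊≟⌋-≢ i≢k = refl

  toggle-involutive : ∀ {d} (w : Vertex d) k → toggle (toggle w k) k ≗ w
  toggle-involutive w k i with i ≟ k
  ... | yes refl = not-involutive (w i)
  ... | no _     = refl

allF⇒ : ∀ {n} {f : Fin n → Bool} → allF f ≡ true → ∀ k → f k ≡ true
allF⇒ {suc n} {f} all k with f zero in f₀
allF⇒ {suc n} {f} all zero    | true = f₀
allF⇒ {suc n} {f} all (suc k) | true = allF⇒ all k

allF⇐ : ∀ {n} {f : Fin n → Bool} → (∀ k → f k ≡ true) → allF f ≡ true
allF⇐ {zero}  f≡true = refl
allF⇐ {suc n} f≡true rewrite f≡true zero = allF⇐ (f≡true ∘ suc)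

SatisfiesPins : Bool → Bool → Bool → Set
SatisfiesPins i j v = (i ≡ true → v ≡ false) × (j ≡ true → v ≡ true)

subcube-∋ : ∀ {d} {I J : Fin d → Bool} {a} → subcube I J a ≡ true → ∀ k → SatisfiesPins (I k) (J k) (a k)
subcube-∋ {I = I} {J} {a} a∈ k = pins (I k) (J k) (a k) (allF⇒ a∈ k)
  where
  pins : ∀ i j v → ((not i ∨ not v) ∧ (not j ∨ v)) ≡ true → SatisfiesPins i j v
  pins false false v     _ = (λ ()) , (λ ())
  pins false true  true  _ = (λ ()) , (λ _ → refl)
  pins true  false false _ = (λ _ → refl) , (λ ())
  pins false true  false ()
  pins true  _     true  ()
  pins true  true  false ()

subcube-∋⁻ : ∀ {d} {I J : Fin d → Bool} {a} → (∀ k → SatisfiesPins (I k) (J k) (a k)) → subcube I J a ≡ true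
subcube-∋⁻ {I = I} {J} {a} sat = allF⇐ (λ k → pins (I k) (J k) (a k) (sat k))
  where
  pins : ∀ i j v → SatisfiesPins i j v → ((not i ∨ not v) ∧ (not j ∨ v)) ≡ true
  pins false false _     _           = refl
  pins false true  v     (_ , j⇒v)   = j⇒v refl
  pins true  false false _           = refl
  pins true  false true  (i⇒¬v , _)  = contradiction (i⇒¬v refl) λ ()
  pins true  true  v     (i⇒¬v , j⇒v) = contradiction (trans (sym (j⇒v refl)) (i⇒¬v refl)) λ ()

opaque
  agreeOn : ∀ {d} → Vertex d → (Fin d → Bool) → Vertex d → Bool
  agreeOn w D = subcube (λ k → D k ∧ not (w k)) (λ k → D k ∧ w k)

  agreeOn-isFace : ∀ {d} (w : Vertex d) D → IsFaceOf cubePt (agreeOn w D)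
  agreeOn-isFace w D = subcube-isFace (λ k → D k ∧ not (w k)) (λ k → D k ∧ w k)

  agreeOn-∋ : ∀ {d} (w : Vertex d) D {a} → agreeOn w D a ≡ true → ∀ k → D k ≡ true → a k ≡ w k
  agreeOn-∋ w D {a} a∈ k =
    agree (D k) (w k) (a k) (subcube-∋ {I = λ k → D k ∧ not (w k)} {λ k → D k ∧ w k} a∈ k)
    where
    agree : ∀ δ ω α → SatisfiesPins (δ ∧ not ω) (δ ∧ ω) α → δ ≡ true → α ≡ ω
    agree true false α (f , _) _ = f refl
    agree true true  α (_ , t) _ = t refl
    agree false ω    α _       ()

  agreeOn-∋⁻ : ∀ {d} (w : Vertex d) D {a} → (∀ k → D k ≡ true → a k ≡ w k) → agreeOn w D a ≡ true
  agreeOn-∋⁻ w D {a} agrees = subcube-∋⁻ (λ k → pins (D k) (w k) (a k) (agrees k))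
    where
    pins : ∀ δ ω α → (δ ≡ true → α ≡ ω) → SatisfiesPins (δ ∧ not ω) (δ ∧ ω) α
    pins true  false α α≡ω = (λ _ → α≡ω refl) , (λ ())
    pins true  true  α α≡ω = (λ ()) , (λ _ → α≡ω refl)
    pins false ω     α _   = (λ ()) , (λ ())

facet : ∀ {d} → Vertex d → Fin d → Vertex d → Bool
facet w k = agreeOn w ⟦ k ⟧₁

facet-isFace : ∀ {d} (w : Vertex d) k → IsFaceOf cubePt (facet w k)
facet-isFace w k = agreeOn-isFace w ⟦ k ⟧₁

facet-∋ : ∀ {d} (w : Vertex d) k {a} → facet w k a ≡ true → a k ≡ w k
facet-∋ w k a∈ = agreeOn-∋ w ⟦ k ⟧₁ a∈ k (⌊≟⌋-refl k)

facet-∋⁻ : ∀ {d} (w : Vertex d) k {a} → a k ≡ w k → facet w k a ≡ true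
facet-∋⁻ w k {a} ak≡wk = agreeOn-∋⁻ w ⟦ k ⟧₁ λ i i∈ → subst (λ i → a i ≡ w i) (sym (⌊≟⌋⇒≡ i∈)) ak≡wk

-- The face {a | a x ≡ α, a y ≡ β}, defined by cases so that for literal α and β it is
-- literally the face F_I^J of the statement, e.g. pinnedFace x y false true = subcube ⟦ x ⟧₁ ⟦ y ⟧₁.
pinnedI : ∀ {d} → Fin d → Fin d → Bool → Bool → Fin d → Bool
pinnedI x y false false = ⟦ x , y ⟧₂
pinnedI x y false true  = ⟦ x ⟧₁
pinnedI x y true  false = ⟦ y ⟧₁
pinnedI x y true  true  = ∅ₛ

pinnedJ : ∀ {d} → Fin d → Fin d → Bool → Bool → Fin d → Bool
pinnedJ x y false false = ∅ₛ
pinnedJ x y false true  = ⟦ y ⟧₁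
pinnedJ x y true  false = ⟦ x ⟧₁
pinnedJ x y true  true  = ⟦ x , y ⟧₂

pinnedFace : ∀ {d} → Fin d → Fin d → Bool → Bool → Vertex d → Bool
pinnedFace x y α β = subcube (pinnedI x y α β) (pinnedJ x y α β)

pinnedFace-isFace : ∀ {d} (x y : Fin d) α β → IsFaceOf cubePt (pinnedFace x y α β)
pinnedFace-isFace x y α β = subcube-isFace (pinnedI x y α β) (pinnedJ x y α β)

module _ {d} (x y : Fin d) where

  ⟦x,y⟧-∋x : ⟦ x , y ⟧₂ x ≡ true
  ⟦x,y⟧-∋x = cong (_∨ ⌊ x ≟ y ⌋) (⌊≟⌋-refl x)

  ⟦x,y⟧-∋y : ⟦ x , y ⟧₂ y ≡ true
  ⟦x,y⟧-∋y = trans (cong (⌊ y ≟ x ⌋ ∨_) (⌊≟⌋-refl y)) (∨-zeroʳ _)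

  ⟦x,y⟧-∋⁻ : ∀ {k} → ⟦ x , y ⟧₂ k ≡ true → k ≡ x ⊎ k ≡ y
  ⟦x,y⟧-∋⁻ {k} k∈ with k ≟ x | k ≟ y
  ... | yes k≡x | _       = inj₁ k≡x
  ... | no _    | yes k≡y = inj₂ k≡y

  pinnedFace-∋ : ∀ {α β a} → pinnedFace x y α β a ≡ true → a x ≡ α × a y ≡ β
  pinnedFace-∋ {α} {β} {a} a∈ = at α β (subcube-∋ {I = pinnedI x y α β} {pinnedJ x y α β} a∈)
    where
    at : ∀ α β → (∀ k → SatisfiesPins (pinnedI x y α β k) (pinnedJ x y α β k) (a k)) → a x ≡ α × a y ≡ β
    at false false pins = proj₁ (pins x) ⟦x,y⟧-∋x , proj₁ (pins y) ⟦x,y⟧-∋y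
    at false true  pins = proj₁ (pins x) (⌊≟⌋-refl x) , proj₂ (pins y) (⌊≟⌋-refl y)
    at true  false pins = proj₂ (pins x) (⌊≟⌋-refl x) , proj₁ (pins y) (⌊≟⌋-refl y)
    at true  true  pins = proj₂ (pins x) ⟦x,y⟧-∋x , proj₂ (pins y) ⟦x,y⟧-∋y

  pinnedFace-∋⁻ : ∀ {α β a} → a x ≡ α → a y ≡ β → pinnedFace x y α β a ≡ true
  pinnedFace-∋⁻ {α} {β} {a} ax ay = subcube-∋⁻ {I = pinnedI x y α β} {pinnedJ x y α β} (at α β ax ay)
    where
    at-x : ∀ {k α} → ⌊ k ≟ x ⌋ ≡ true → a x ≡ α → a k ≡ α
    at-x k∈ = subst (λ k → a k ≡ _) (sym (⌊≟⌋⇒≡ k∈))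
    at-y : ∀ {k β} → ⌊ k ≟ y ⌋ ≡ true → a y ≡ β → a k ≡ β
    at-y k∈ = subst (λ k → a k ≡ _) (sym (⌊≟⌋⇒≡ k∈))
    at-x-or-y : ∀ {k γ} → ⟦ x , y ⟧₂ k ≡ true → a x ≡ γ → a y ≡ γ → a k ≡ γ
    at-x-or-y {k} k∈ ax≡γ ay≡γ with ⟦x,y⟧-∋⁻ {k} k∈
    ... | inj₁ refl = ax≡γ
    ... | inj₂ refl = ay≡γ
    at : ∀ α β → a x ≡ α → a y ≡ β → ∀ k → SatisfiesPins (pinnedI x y α β k) (pinnedJ x y α β k) (a k)
    at false false ax ay k = (λ k∈ → at-x-or-y k∈ ax ay) , λ ()
    at false true  ax ay k = (λ k∈ → at-x k∈ ax) , (λ k∈ → at-y k∈ ay)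
    at true  false ax ay k = (λ k∈ → at-y k∈ ay) , (λ k∈ → at-x k∈ ax)
    at true  true  ax ay k = (λ ()) , (λ k∈ → at-x-or-y k∈ ax ay)

cubeFace-resp : ∀ {d S} → IsFaceOf cubePt S → ∀ {a a′ : Vertex d} → a ≗ a′ → S a ≡ true → S a′ ≡ true
cubeFace-resp (c , b , _ , on-level) {a} {a′} a≗a′ a∈ =
  proj₁ (on-level a′) (trans (·-resp c (λ k → cong bit (sym (a≗a′ k)))) (proj₂ (on-level a) a∈))

IsFaceOf-resp : ∀ {d n} {P : Fin n → Point d} {G G′} → G ≗ G′ → IsFaceOf P G → IsFaceOf P G′
IsFaceOf-resp G≗G′ (c , b , ≤b , on-level) = c , b , ≤b , λ j →
  (λ on → trans (sym (G≗G′ j)) (proj₁ (on-level j) on)) , (λ j∈ → proj₂ (on-level j) (trans (G≗G′ j) j∈))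

emptyFace : ∀ {d} {A : Set} (Q : A → Point d) → IsFaceOf Q (λ _ → false)
emptyFace Q = 0ᵥ , 1ℤ , (λ a → subst (ℤ._≤ 1ℤ) (sym (0ᵥ· (Q a))) (ℤ.+≤+ ℕ.z≤n))
            , λ a → (λ on → contradiction (trans (sym (0ᵥ· (Q a))) on) λ ()) , λ ()
  where
  0ᵥ· : ∀ z → 0ᵥ · z ≡ 0ℤ
  0ᵥ· z = Σℤ-zero {f = λ k → 0ℤ * z k} (λ k → refl)

module VertexMap {d n} {P : Fin n → Point d} (all-vertices : AllVertices P) (cc : CombCube d n P) where
  open CombCube cc

  ⟨_⟩ : Vertex d → Vertex d → Bool
  ⟨ w ⟩ = agreeOn w (λ _ → true)

  ⟨⟩-isFace : ∀ w → IsFaceOf cubePt ⟨ w ⟩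
  ⟨⟩-isFace w = agreeOn-isFace w (λ _ → true)

  φ⟨_⟩ : Vertex d → Fin n → Bool
  φ⟨ w ⟩ = φ ⟨ w ⟩ (⟨⟩-isFace w)

  ⟨⟩-∋ : ∀ {w a} → ⟨ w ⟩ a ≡ true → a ≗ w
  ⟨⟩-∋ {w} a∈ k = agreeOn-∋ w (λ _ → true) a∈ k refl

  ⟨⟩-∋⁻ : ∀ {w a} → a ≗ w → ⟨ w ⟩ a ≡ true
  ⟨⟩-∋⁻ {w} a≗w = agreeOn-∋⁻ w (λ _ → true) (λ k _ → a≗w k)

  ⟨⟩-⊆ : ∀ {S} (p : IsFaceOf cubePt S) {w} → S w ≡ true → ⟨ w ⟩ ⊆ S
  ⟨⟩-⊆ p {w} w∈ a a∈ = cubeFace-resp p (λ k → sym (⟨⟩-∋ {w} a∈ k)) w∈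

  φ-∅ : ∀ j → φ (λ _ → false) (emptyFace cubePt) j ≢ true
  φ-∅ j j∈ with φ-surj (λ _ → false) (emptyFace P)
  ... | S , p , φS≗∅ = contradiction (trans (sym (φ-mono _ _ S p (λ _ ()) j j∈)) (φS≗∅ j)) λ ()

  opaque
    vertex-exists : ∀ w → ∃ λ j → φ⟨ w ⟩ j ≡ true
    vertex-exists w with FinP.any? (λ j → φ⟨ w ⟩ j Bool.≟ true)
    ... | yes j∈ = j∈
    ... | no none = contradiction
      (φ-refl ⟨ w ⟩ _ _ (emptyFace cubePt) (λ j j∈ → contradiction (j , j∈) none) w (⟨⟩-∋⁻ {w} λ _ → refl)) λ ()

  vertex : Vertex d → Fin n
  vertex w = proj₁ (vertex-exists w)

  vertex-∈ : ∀ {S} (p : IsFaceOf cubePt S) {a} → S a ≡ true → φ S p (vertex a) ≡ true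
  vertex-∈ p {a} a∈ = φ-mono ⟨ a ⟩ _ _ p (⟨⟩-⊆ p a∈) (vertex a) (proj₂ (vertex-exists a))

  module Preimage (j : Fin n) where
    T : Vertex d → Bool
    T = proj₁ (φ-surj _ (all-vertices j))

    T-isFace : IsFaceOf cubePt T
    T-isFace = proj₁ (proj₂ (φ-surj _ (all-vertices j)))

    φT≗ : ∀ i → φ T T-isFace i ≡ ⌊ i ≟ j ⌋
    φT≗ = proj₂ (proj₂ (φ-surj _ (all-vertices j)))

    T-⊆ : ∀ {S} (p : IsFaceOf cubePt S) → φ S p j ≡ true → T ⊆ S
    T-⊆ p j∈ = φ-refl T T-isFace _ p λ i i∈ →
      subst (λ i → φ _ p i ≡ true) (sym (⌊≟⌋⇒≡ (trans (sym (φT≗ i)) i∈))) j∈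

    T-∋⇒vertex : ∀ {a} → T a ≡ true → vertex a ≡ j
    T-∋⇒vertex a∈ = ⌊≟⌋⇒≡ (trans (sym (φT≗ _)) (vertex-∈ T-isFace a∈))

    T-nonempty : (∀ a → T a ≢ true) → ⊥
    T-nonempty T-empty = φ-∅ j
      (φ-mono T T-isFace _ (emptyFace cubePt) (λ a a∈ → contradiction a∈ (T-empty a)) j
        (trans (φT≗ j) (⌊≟⌋-refl j)))

    T-between : ∀ w w′ → (∀ a → T a ≡ true → a ≗ w ⊎ a ≗ w′) → vertex w ≡ j ⊎ vertex w′ ≡ j
    T-between w w′ T-two with T w in Tw | T w′ in Tw′
    ... | true  | _     = inj₁ (T-∋⇒vertex Tw)
    ... | false | true  = inj₂ (T-∋⇒vertex Tw′)
    ... | false | false = ⊥-elim (T-nonempty λ a a∈ →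
      [ (λ a≗w → not-¬ Tw (cubeFace-resp T-isFace a≗w a∈))
      , (λ a≗w′ → not-¬ Tw′ (cubeFace-resp T-isFace a≗w′ a∈)) ]′ (T-two a a∈))

  ∈φ-between : ∀ {S} (p : IsFaceOf cubePt S) {j} w w′ → φ S p j ≡ true →
               (∀ a → S a ≡ true → a ≗ w ⊎ a ≗ w′) → j ≡ vertex w ⊎ j ≡ vertex w′
  ∈φ-between p {j} w w′ j∈ S-between =
    Sum.map sym sym (T-between w w′ λ a a∈ → S-between a (T-⊆ p j∈ a a∈))
    where open Preimage j

  vertex-unique : ∀ {w j} → φ⟨ w ⟩ j ≡ true → j ≡ vertex w
  vertex-unique {w} j∈ = reduce (∈φ-between (⟨⟩-isFace w) w w j∈ (λ a a∈ → inj₁ (⟨⟩-∋ {w} a∈)))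

  vertex-∈⁻ : ∀ {S} (p : IsFaceOf cubePt S) {a} → φ S p (vertex a) ≡ true → S a ≡ true
  vertex-∈⁻ p {a} v∈ = φ-refl ⟨ a ⟩ (⟨⟩-isFace a) _ p
    (λ i i∈ → subst (λ i → φ _ p i ≡ true) (sym (vertex-unique {a} i∈)) v∈) a (⟨⟩-∋⁻ {a} λ _ → refl)

  vertex-injective : ∀ {a b} → vertex a ≡ vertex b → a ≗ b
  vertex-injective {a} {b} va≡vb =
    ⟨⟩-∋ {b} (vertex-∈⁻ (⟨⟩-isFace b) (subst (λ j → φ⟨ b ⟩ j ≡ true) (sym va≡vb) (proj₂ (vertex-exists b))))

  edge : Vertex d → Fin d → Vertex d → Bool
  edge w k = agreeOn w (λ i → not ⌊ i ≟ k ⌋)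

  edge-isFace : ∀ w k → IsFaceOf cubePt (edge w k)
  edge-isFace w k = agreeOn-isFace w (λ i → not ⌊ i ≟ k ⌋)

  edge-off : ∀ {w k a} → edge w k a ≡ true → ∀ {i} → i ≢ k → a i ≡ w i
  edge-off {w} {k} a∈ {i} i≢k = agreeOn-∋ w (λ i → not ⌊ i ≟ k ⌋) a∈ i (cong not (⌊≟⌋-≢ i≢k))

  edge-∋ : ∀ {w k a} → edge w k a ≡ true → a ≗ w ⊎ a ≗ toggle w k
  edge-∋ {w} {k} {a} a∈ with a k Bool.≟ w k
  ... | yes ak≡wk = inj₁ (agree-off k ak≡wk (edge-off a∈))
  ... | no  ak≢wk = inj₂ (agree-off k (trans (¬-not ak≢wk) (sym (toggle-≡ w k)))
                                      (λ i≢k → trans (edge-off a∈ i≢k) (sym (toggle-≢ w i≢k))))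

  vertex-edge : ∀ w k → IsEdge P (vertex w) (vertex (toggle w k))
  vertex-edge w k = distinct , IsFaceOf-resp members (φ-face (edge w k) (edge-isFace w k))
    where
    distinct : vertex w ≢ vertex (toggle w k)
    distinct vw≡vt = not-¬ refl (trans (vertex-injective vw≡vt k) (toggle-≡ w k))
    start∈ : edge w k w ≡ true
    start∈ = agreeOn-∋⁻ w (λ i → not ⌊ i ≟ k ⌋) (λ _ _ → refl)
    end∈ : edge w k (toggle w k) ≡ true
    end∈ = agreeOn-∋⁻ w (λ i → not ⌊ i ≟ k ⌋) (λ i i∈ → toggle-≢ w (not⌊≟⌋⇒≢ i∈))
    members : φ (edge w k) (edge-isFace w k) ≗ ⟦ vertex w , vertex (toggle w k) ⟧₂
    members j = ⇔→≡ {z = true} (mk⇔ to from)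
      where
      to : φ (edge w k) (edge-isFace w k) j ≡ true → ⟦ vertex w , vertex (toggle w k) ⟧₂ j ≡ true
      to j∈ with ∈φ-between (edge-isFace w k) w (toggle w k) j∈ (λ a → edge-∋)
      ... | inj₁ refl = ⟦x,y⟧-∋x (vertex w) (vertex (toggle w k))
      ... | inj₂ refl = ⟦x,y⟧-∋y (vertex w) (vertex (toggle w k))
      from : ⟦ vertex w , vertex (toggle w k) ⟧₂ j ≡ true → φ (edge w k) (edge-isFace w k) j ≡ true
      from j∈ with ⟦x,y⟧-∋⁻ (vertex w) (vertex (toggle w k)) {j} j∈
      ... | inj₁ refl = vertex-∈ (edge-isFace w k) start∈
      ... | inj₂ refl = vertex-∈ (edge-isFace w k) end∈

module Frame {d n} {P : Fin n → Point d} (all-vertices : AllVertices P) (smooth : Smooth P)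
             (cc : CombCube d n P) (w : Vertex d) where
  open CombCube cc
  open VertexMap all-vertices cc

  v : Fin n
  v = vertex w

  e : Fin d → Fin n
  e = proj₁ (smooth v)

  e-complete : ∀ j → IsEdge P v j → ∃ λ l → e l ≡ j
  e-complete = proj₁ (proj₂ (proj₂ (proj₂ (smooth v))))

  u : Fin d → Point d
  u = proj₁ (proj₂ (proj₂ (proj₂ (proj₂ (smooth v)))))

  u-primitive : ∀ l → PrimitiveDirOf (u l) (P (e l) ⊖ₚ P v)
  u-primitive = proj₁ (proj₂ (proj₂ (proj₂ (proj₂ (proj₂ (smooth v))))))

  u-basis : IsZBasis u
  u-basis = proj₂ (proj₂ (proj₂ (proj₂ (proj₂ (proj₂ (smooth v))))))

  open Coordinates u-basis public

  -- `Smooth` enumerates the edges at v by Fin d; edgeIndex k is the index of the edge in cube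
  -- direction k, and direction is its inverse.
  edgeIndex : Fin d → Fin d
  edgeIndex k = proj₁ (e-complete _ (vertex-edge w k))

  e∘edgeIndex : ∀ k → e (edgeIndex k) ≡ vertex (toggle w k)
  e∘edgeIndex k = proj₂ (e-complete _ (vertex-edge w k))

  edgeIndex-injective : ∀ {k k′} → edgeIndex k ≡ edgeIndex k′ → k ≡ k′
  edgeIndex-injective {k} {k′} same-index with k ≟ k′
  ... | yes k≡k′ = k≡k′
  ... | no  k≢k′ = contradiction (sym not-wk≡wk) (not-¬ refl)
    where
    not-wk≡wk : not (w k) ≡ w k
    not-wk≡wk = begin
      not (w k)        ≡⟨ sym (toggle-≡ w k) ⟩
      toggle w k k     ≡⟨ vertex-injective (trans (sym (e∘edgeIndex k)) (trans (cong e same-index) (e∘edgeIndex k′))) k ⟩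
      toggle w k′ k    ≡⟨ toggle-≢ w k≢k′ ⟩
      w k              ∎
      where open ≡-Reasoning

  direction : Fin d → Fin d
  direction l = proj₁ (Fin-injective⇒surjective edgeIndex edgeIndex-injective l)

  edgeIndex∘direction : ∀ l → edgeIndex (direction l) ≡ l
  edgeIndex∘direction l = proj₂ (Fin-injective⇒surjective edgeIndex edgeIndex-injective l)

  direction-injective : ∀ {l l′} → direction l ≡ direction l′ → l ≡ l′
  direction-injective {l} {l′} eq = trans (sym (edgeIndex∘direction l)) (trans (cong edgeIndex eq) (edgeIndex∘direction l′))

  neighbour : Fin d → Fin n
  neighbour l = vertex (toggle w (direction l))

  multiplicity : Fin d → ℕ
  multiplicity l = proj₁ (proj₂ (u-primitive l))

  multiplicity>0 : ∀ l → 0 ℕ.< multiplicity l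
  multiplicity>0 l = proj₁ (proj₂ (proj₂ (u-primitive l)))

  edge-vector : ∀ l → P (neighbour l) ⊖ₚ P v ≗ (+ multiplicity l) • u l
  edge-vector l k = subst (λ j → P j k - P v k ≡ + multiplicity l * u l k)
    (trans (cong e (sym (edgeIndex∘direction l))) (e∘edgeIndex (direction l))) (proj₂ (proj₂ (proj₂ (u-primitive l))) k)

  ·-edge : ∀ c l → + multiplicity l * (c · u l) ≡ c · (P (neighbour l) ⊖ₚ P v)
  ·-edge c l = trans (sym (·-• c (+ multiplicity l) (u l))) (·-resp c (λ k → sym (edge-vector l k)))

  ·-edge-≡0 : ∀ c l → c · u l ≡ 0ℤ → c · (P (neighbour l) ⊖ₚ P v) ≡ 0ℤ
  ·-edge-≡0 c l c·u≡0 = begin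
    c · (P (neighbour l) ⊖ₚ P v)  ≡⟨ sym (·-edge c l) ⟩
    + multiplicity l * (c · u l)  ≡⟨ cong (+ multiplicity l *_) c·u≡0 ⟩
    + multiplicity l * 0ℤ         ≡⟨ ℤP.*-zeroʳ (+ multiplicity l) ⟩
    0ℤ                            ∎
    where open ≡-Reasoning

  Stays : (Vertex d → Bool) → Fin d → Set
  Stays S l = S (toggle w (direction l)) ≡ true

  FrameSpan : (Vertex d → Bool) → Point d → Set
  FrameSpan S z = ∀ l → ¬ Stays S l → coord z l ≡ 0ℤ

  module AtFace {S} (p : IsFaceOf cubePt S) (w∈S : S w ≡ true) where
    open SupportingHyperplane (φ-face S p) public

    v∈ : φ S p v ≡ true
    v∈ = vertex-∈ p w∈S

    normal·u-≤0 : ∀ l → normal · u l ℤ.≤ 0ℤ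
    normal·u-≤0 l = pos*-≤0 (multiplicity>0 l) (subst (ℤ._≤ 0ℤ) (sym (·-edge normal l)) (normal·diff-≤0 (neighbour l) v∈))

    normal·u-≡0 : ∀ {l} → Stays S l → normal · u l ≡ 0ℤ
    normal·u-≡0 {l} stays = pos*-≡0 (multiplicity>0 l) (trans (·-edge normal l) (normal·diff-≡0 v∈ (vertex-∈ p stays)))

    normal·u-≢0 : ∀ {l} → ¬ Stays S l → normal · u l ≢ 0ℤ
    normal·u-≢0 {l} leaves ≡0 = leaves (vertex-∈⁻ p (normal·diff-≡0⇒∈ v∈ (·-edge-≡0 normal l ≡0)))

    normal·u-<0 : ∀ {l} → ¬ Stays S l → normal · u l ℤ.< 0ℤ
    normal·u-<0 leaves = ℤP.≤∧≢⇒< (normal·u-≤0 _) (normal·u-≢0 leaves)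

    u∈span : ∀ {l} → Stays S l → InSpanDir P (φ S p) (u l)
    u∈span {l} stays = ∈-divide (multiplicity l) (multiplicity>0 l)
      (∈-resp-≗ (edge-vector l) (span-∋-diff P (φ S p) v∈ (vertex-∈ p stays)))
      where open IsSaturatedSublattice (span-saturated P (φ S p))

    frameSpan⊆span : FrameSpan S ⊆ᵖ InSpanDir P (φ S p)
    frameSpan⊆span {z} z∈ = ∈-resp-≗ (λ k → sym (coord-expansion z k)) (Σᵥ∈ _ term∈)
      where
      open IsSaturatedSublattice (span-saturated P (φ S p))
      term∈ : ∀ l → InSpanDir P (φ S p) (coord z l • u l)
      term∈ l with S (toggle w (direction l)) in stays
      ... | true  = •∈ (coord z l) (u∈span stays)
      ... | false = ∈-resp-≗ (λ k → sym (cong (_* u l k) (z∈ l (not-¬ stays)))) 0ᵥ∈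

  -- The facet through w transverse to direction l contains every other edge at v, so its normal
  -- pairs with P j ⊖ₚ P v only through the l-th coordinate.
  coord-nonneg : ∀ j l → 0ℤ ℤ.≤ coord (P j ⊖ₚ P v) l
  coord-nonneg j l = *-neg-≤0⇒0≤ _ _ (subst (ℤ._≤ 0ℤ) expansion (normal·diff-≤0 j v∈)) (normal·u-<0 leaves)
    where
    open AtFace (facet-isFace w (direction l)) (facet-∋⁻ w (direction l) refl)
    stays : ∀ {l′} → l′ ≢ l → Stays (facet w (direction l)) l′
    stays l′≢l = facet-∋⁻ w (direction l) (toggle-≢ w (λ dl≡dl′ → l′≢l (direction-injective (sym dl≡dl′))))
    leaves : ¬ Stays (facet w (direction l)) l
    leaves st = not-¬ refl (sym (trans (sym (toggle-≡ w (direction l))) (facet-∋ w (direction l) st)))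
    expansion : normal · (P j ⊖ₚ P v) ≡ coord (P j ⊖ₚ P v) l * (normal · u l)
    expansion = trans (·-expansion normal (P j ⊖ₚ P v))
      (Σℤ-single _ l λ l′ l′≢l → trans (cong (coord (P j ⊖ₚ P v) l′ *_) (normal·u-≡0 (stays l′≢l)))
                                       (ℤP.*-zeroʳ (coord (P j ⊖ₚ P v) l′)))

  module SpanAtFace {S} (p : IsFaceOf cubePt S) (w∈S : S w ≡ true) where
    open AtFace p w∈S public

    terms-vanish : ∀ {j} → φ S p j ≡ true → ∀ l → coord (P j ⊖ₚ P v) l * (normal · u l) ≡ 0ℤ
    terms-vanish {j} j∈ = Σℤ-nonPos-≡0 (λ l → coord (P j ⊖ₚ P v) l * (normal · u l))
      (λ l → nonNeg*nonPos≤0 (coord-nonneg j l) (normal·u-≤0 l))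
      (trans (sym (·-expansion normal (P j ⊖ₚ P v))) (normal·diff-≡0 v∈ j∈))

    coord-leaving≡0 : ∀ {j l} → φ S p j ≡ true → ¬ Stays S l → coord (P j ⊖ₚ P v) l ≡ 0ℤ
    coord-leaving≡0 {j} {l} j∈ leaves =
      [ id , (λ normal·u≡0 → contradiction normal·u≡0 (normal·u-≢0 leaves)) ]′
      (ℤP.i*j≡0⇒i≡0∨j≡0 (coord (P j ⊖ₚ P v) l) (terms-vanish j∈ l))

    span⊆frameSpan : InSpanDir P (φ S p) ⊆ᵖ FrameSpan S
    span⊆frameSpan = span-least-based P (φ S p) (coordKernel-saturated (¬_ ∘ Stays S)) v∈
      (λ j j∈ l leaves → coord-leaving≡0 j∈ leaves)

  span-∩ : ∀ {S T R} (p : IsFaceOf cubePt S) (q : IsFaceOf cubePt T) (r : IsFaceOf cubePt R) →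
           S w ≡ true → T w ≡ true → R w ≡ true → (∀ a → S a ≡ true → T a ≡ true → R a ≡ true) →
           InSpanDir P (φ S p) ∩ InSpanDir P (φ T q) ⊆ᵖ InSpanDir P (φ R r)
  span-∩ {S} {T} {R} p q r w∈S w∈T w∈R S∩T⊆R (z∈S , z∈T) = SpanAtFace.frameSpan⊆span r w∈R λ l leavesR →
    [ SpanAtFace.span⊆frameSpan p w∈S z∈S l , SpanAtFace.span⊆frameSpan q w∈T z∈T l ]′ (leaves-S-or-T leavesR)
    where
    leaves-S-or-T : ∀ {l} → ¬ Stays R l → ¬ Stays S l ⊎ ¬ Stays T l
    leaves-S-or-T {l} leavesR with S (toggle w (direction l)) in s | T (toggle w (direction l)) in t
    ... | false | _     = inj₁ λ ()
    ... | true  | false = inj₂ λ ()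
    ... | true  | true  = ⊥-elim (leavesR (S∩T⊆R _ s t))

module PinnedFaces {d n} {P : Fin n → Point d} (all-vertices : AllVertices P) (smooth : Smooth P)
                   (cc : CombCube d n P) {x y : Fin d} (x≢y : x ≢ y) where
  open CombCube cc
  open VertexMap all-vertices cc

  F : Bool → Bool → Fin n → Bool
  F α β = φ (pinnedFace x y α β) (pinnedFace-isFace x y α β)

  Span : Bool → Bool → Point d → Set
  Span α β = InSpanDir P (F α β)

  module _ (α β : Bool) where
    private
      w₀ w₁ : Vertex d
      w₀ k = if ⌊ k ≟ x ⌋ then α else β
      w₁ = toggle w₀ x

      w₀x : w₀ x ≡ α
      w₀x rewrite ⌊≟⌋-refl x = refl
      w₀y : w₀ y ≡ β
      w₀y rewrite ⌊≟⌋-≢ (x≢y ∘ sym) = refl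
      w₁x : w₁ x ≡ not α
      w₁x = trans (toggle-≡ w₀ x) (cong not w₀x)
      w₁y : w₁ y ≡ β
      w₁y = trans (toggle-≢ w₀ (x≢y ∘ sym)) w₀y

      E Ex Ey X Y : Vertex d → Bool
      E  = pinnedFace x y α β
      Ex = pinnedFace x y (not α) β
      Ey = pinnedFace x y α (not β)
      X  = facet w₀ x
      Y  = facet w₀ y
      pE : IsFaceOf cubePt E
      pE = pinnedFace-isFace x y α β
      pEx : IsFaceOf cubePt Ex
      pEx = pinnedFace-isFace x y (not α) β
      pEy : IsFaceOf cubePt Ey
      pEy = pinnedFace-isFace x y α (not β)
      pX : IsFaceOf cubePt X
      pX = facet-isFace w₀ x
      pY : IsFaceOf cubePt Y
      pY = facet-isFace w₀ y

      E⊆X : E ⊆ X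
      E⊆X a a∈ = facet-∋⁻ w₀ x (trans (proj₁ (pinnedFace-∋ x y {β = β} a∈)) (sym w₀x))
      E⊆Y : E ⊆ Y
      E⊆Y a a∈ = facet-∋⁻ w₀ y (trans (proj₂ (pinnedFace-∋ x y {α} a∈)) (sym w₀y))
      Ex⊆Y : Ex ⊆ Y
      Ex⊆Y a a∈ = facet-∋⁻ w₀ y (trans (proj₂ (pinnedFace-∋ x y {not α} a∈)) (sym w₀y))
      Ey⊆X : Ey ⊆ X
      Ey⊆X a a∈ = facet-∋⁻ w₀ x (trans (proj₁ (pinnedFace-∋ x y {β = not β} a∈)) (sym w₀x))
      X∩Y⊆E : ∀ a → X a ≡ true → Y a ≡ true → E a ≡ true
      X∩Y⊆E a inX inY = pinnedFace-∋⁻ x y (trans (facet-∋ w₀ x inX) w₀x) (trans (facet-∋ w₀ y inY) w₀y)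

      w₁∉X : X w₁ ≢ true
      w₁∉X inX = not-¬ refl (sym (trans (sym (toggle-≡ w₀ x)) (facet-∋ w₀ x inX)))

      Y-neighbour⇒Ex : ∀ {k} → k ≢ x → Y (toggle w₁ k) ≡ true → Ex (toggle w₁ k) ≡ true
      Y-neighbour⇒Ex k≢x inY =
        pinnedFace-∋⁻ x y (trans (toggle-≢ w₁ (k≢x ∘ sym)) w₁x) (trans (facet-∋ w₀ y inY) w₀y)

      module A = Frame all-vertices smooth cc w₀
      module B = Frame all-vertices smooth cc w₁

    span-flipˣ⊆span : Span (not α) β ⊆ᵖ Span α (not β) → Span (not α) β ⊆ᵖ Span α β
    span-flipˣ⊆span Ex⊆Ey z∈Ex =
      A.span-∩ pX pY pE (facet-∋⁻ w₀ x refl) (facet-∋⁻ w₀ y refl) (pinnedFace-∋⁻ x y w₀x w₀y) X∩Y⊆E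
      (span-mono P (φ-mono Ey pEy X pX Ey⊆X) (Ex⊆Ey z∈Ex) , span-mono P (φ-mono Ex pEx Y pY Ex⊆Y) z∈Ex)

    private
      open SupportingHyperplane (φ-face X pX) using (normal; span⊆kernel; normal·diff-≡0⇒∈′)

      w₁∈Ex : Ex w₁ ≡ true
      w₁∈Ex = pinnedFace-∋⁻ x y w₁x w₁y
      w₁∈Y : Y w₁ ≡ true
      w₁∈Y = facet-∋⁻ w₀ y (trans w₁y (sym w₀y))

      x-edge-not-flat : ∀ l → B.direction l ≡ x → normal · B.u l ≢ 0ℤ
      x-edge-not-flat l dl≡x ≡0 = w₁∉X (vertex-∈⁻ pX (normal·diff-≡0⇒∈′ w₀∈X (B.·-edge-≡0 normal l ≡0)))
        where
        w₀∈X : φ X pX (B.neighbour l) ≡ true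
        w₀∈X = vertex-∈ pX (facet-∋⁻ w₀ x (trans (cong (λ k → toggle w₁ k x) dl≡x) (toggle-involutive w₀ x x)))

    span⊆span-flipˣ : Span (not α) β ⊆ᵖ Span α β → Span α β ⊆ᵖ Span (not α) β
    span⊆span-flipˣ Ex⊆E {z} z∈E = B.SpanAtFace.frameSpan⊆span pEx w₁∈Ex coord-vanishes
      where
      E⊆X-span : Span α β ⊆ᵖ InSpanDir P (φ X pX)
      E⊆X-span = span-mono P (φ-mono E pE X pX E⊆X)
      z-FrameSpan-Y : B.FrameSpan Y z
      z-FrameSpan-Y = B.SpanAtFace.span⊆frameSpan pY w₁∈Y (span-mono P (φ-mono E pE Y pY E⊆Y) z∈E)
      off-x-term : ∀ l → B.direction l ≢ x → B.coord z l * (normal · B.u l) ≡ 0ℤ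
      off-x-term l dl≢x with Y (toggle w₁ (B.direction l)) in inY
      ... | true  = trans (cong (B.coord z l *_) (span⊆kernel (E⊆X-span (Ex⊆E
                      (B.AtFace.u∈span pEx w₁∈Ex (Y-neighbour⇒Ex dl≢x inY)))))) (ℤP.*-zeroʳ (B.coord z l))
      ... | false = cong (_* (normal · B.u l)) (z-FrameSpan-Y l (not-¬ inY))
      coord-vanishes : B.FrameSpan Ex z
      coord-vanishes l leaves with B.direction l ≟ x
      ... | no  dl≢x = z-FrameSpan-Y l (λ inY → leaves (Y-neighbour⇒Ex dl≢x inY))
      ... | yes dl≡x = [ id , (λ ≡0 → contradiction ≡0 (x-edge-not-flat l dl≡x)) ]′
                         (ℤP.i*j≡0⇒i≡0∨j≡0 (B.coord z l) x-term≡0)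
        where
        x-term≡0 : B.coord z l * (normal · B.u l) ≡ 0ℤ
        x-term≡0 = begin
          B.coord z l * (normal · B.u l)                ≡⟨ sym (Σℤ-single _ l λ l′ l′≢l → off-x-term l′ λ dl′≡x →
                                                            l′≢l (B.direction-injective (trans dl′≡x (sym dl≡x)))) ⟩
          Σℤ (λ l′ → B.coord z l′ * (normal · B.u l′))  ≡⟨ sym (B.·-expansion normal z) ⟩
          normal · z                                    ≡⟨ span⊆kernel (E⊆X-span z∈E) ⟩
          0ℤ                                            ∎
          where open ≡-Reasoning

    Parallel-flips⇒Parallel-flipˣ : Parallel P (F (not α) β) (F α (not β)) → Parallel P (F α β) (F (not α) β)
    Parallel-flips⇒Parallel-flipˣ Fx∥Fy = span-⊆⇒Parallel P (span⊆span-flipˣ Fx⊆F) Fx⊆F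
      where
      Fx⊆F : Span (not α) β ⊆ᵖ Span α β
      Fx⊆F = span-flipˣ⊆span (Parallel⇒span-⊆ P Fx∥Fy)

ThreeToFourth-via-first : ∀ {d n} (P : Fin n → Point d) {a b c e} →
  (Parallel P a b × Parallel P a c × Parallel P b c → Parallel P e a) → ThreeToFourth P a b c e
ThreeToFourth-via-first P e∥a three@(a∥b , a∥c , _) =
  e∥a three , Parallel-trans P (e∥a three) a∥b , Parallel-trans P (e∥a three) a∥c

corollary3p4 : (d n : ℕ) → 3 ≤ d → (P : Fin n → Point d) →
    AllVertices P → Smooth P → (cc : CombCube d n P) → (x y : Fin d) → x ≢ y →
    ThreeToFourth P (faceIJ cc ⟦ x ⟧₁ ⟦ y ⟧₁) (faceIJ cc ⟦ y ⟧₁ ⟦ x ⟧₁) (faceIJ cc ∅ₛ ⟦ x , y ⟧₂) (faceIJ cc ⟦ x , y ⟧₂ ∅ₛ) ×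
    ThreeToFourth P (faceIJ cc ⟦ x , y ⟧₂ ∅ₛ) (faceIJ cc ⟦ y ⟧₁ ⟦ x ⟧₁) (faceIJ cc ∅ₛ ⟦ x , y ⟧₂) (faceIJ cc ⟦ x ⟧₁ ⟦ y ⟧₁) ×
    ThreeToFourth P (faceIJ cc ⟦ x , y ⟧₂ ∅ₛ) (faceIJ cc ⟦ x ⟧₁ ⟦ y ⟧₁) (faceIJ cc ∅ₛ ⟦ x , y ⟧₂) (faceIJ cc ⟦ y ⟧₁ ⟦ x ⟧₁) ×
    ThreeToFourth P (faceIJ cc ⟦ x , y ⟧₂ ∅ₛ) (faceIJ cc ⟦ x ⟧₁ ⟦ y ⟧₁) (faceIJ cc ⟦ y ⟧₁ ⟦ x ⟧₁) (faceIJ cc ∅ₛ ⟦ x , y ⟧₂)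
corollary3p4 d n _ P all-vertices smooth cc x y x≢y =
    ThreeToFourth-via-first P (λ (a∥b , _ , _) →
      Parallel-trans P (F∥Fˣ false false (Parallel-sym P a∥b)) (Parallel-sym P a∥b))
  , ThreeToFourth-via-first P (λ (_ , a∥c , _) →
      Parallel-trans P (F∥Fˣ false true (Parallel-sym P a∥c)) (Parallel-sym P a∥c))
  , ThreeToFourth-via-first P (λ (_ , a∥c , _) → F∥Fˣ true false a∥c)
  , ThreeToFourth-via-first P (λ (a∥b , _ , b∥c) → Parallel-trans P (F∥Fˣ true true b∥c) (Parallel-sym P a∥b))
  where
  open PinnedFaces all-vertices smooth cc x≢y renaming (Parallel-flips⇒Parallel-flipˣ to F∥Fˣ)
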